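{- No simple connected cubic graph of order eight has \textbf{rna} number one.
   Context: For a graph $G$ of order $N$, the \textbf{rna} number $\sigma^{ - }(G)$ is the minimum, over all bijections $f: V(G)\to\{1,2,\dots,N\}$, of the number of edges $uv$ of $G$ such that $f(u)$ and $f(v)$ have different parity. -}

module Defs where

open import Data.Nat using (ℕ; zero; suc; _%_; _≡ᵇ_; _<ᵇ_; _≤_)
open import Data.Nat.ListAction using (sum)
open import Data.Bool using (Bool; true; false; _∧_; not)
open import Data.Fin using (Fin; toℕ)
open import Data.Fin.Permutation using (Permutation′; _⟨$⟩ʳ_)
open import Data.List using (map; allFin)
open import Data.Product using (Σ; _×_)
open import Relation.Binary.PropositionalEquality using (_≡_)

record SimpleGraph (n : ℕ) : Set where
  field
    adj   : Fin n → Fin n → Bool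
    sym   : ∀ u v → adj u v ≡ adj v u
    loopless : ∀ v → adj v v ≡ false
open SimpleGraph public

⟦_⟧ : Bool → ℕ
⟦ true ⟧  = 1
⟦ false ⟧ = 0

degree : ∀ {n} → SimpleGraph n → Fin n → ℕ
degree {n} G u = sum (map (λ v → ⟦ adj G u v ⟧) (allFin n))

Cubic : ∀ {n} → SimpleGraph n → Set
Cubic {n} G = ∀ (v : Fin n) → degree G v ≡ 3

data Reach {n} (G : SimpleGraph n) : Fin n → Fin n → Set where
  here : ∀ {u} → Reach G u u
  step : ∀ {u v w} → adj G u v ≡ true → Reach G v w → Reach G u w

Connected : ∀ {n} → SimpleGraph n → Set
Connected {n} G = ∀ (u v : Fin n) → Reach G u v

-- A labelling f : V(G) → {1,…,N} bijective is given by a permutation π of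
-- Fin n, with f(v) = toℕ (π v) + 1.
label : ∀ {n} → Permutation′ n → Fin n → ℕ
label π v = suc (toℕ (π ⟨$⟩ʳ v))

differentParity : ℕ → ℕ → Bool
differentParity a b = not ((a % 2) ≡ᵇ (b % 2))

-- number of edges uv (each unordered pair counted once, via u < v)
-- whose labels have different parity
oddEdges : ∀ {n} → SimpleGraph n → Permutation′ n → ℕ
oddEdges {n} G π =
  sum (map (λ u → sum (map (λ v →
        ⟦ (toℕ u <ᵇ toℕ v) ∧ adj G u v ∧ differentParity (label π u) (label π v) ⟧)
      (allFin n))) (allFin n))

IsRnaNumber : ∀ {n} → SimpleGraph n → ℕ → Set
IsRnaNumber {n} G k =
  Σ (Permutation′ n) (λ π → oddEdges G π ≡ k) × (∀ (π : Permutation′ n) → k ≤ oddEdges G π)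

-- Let O be the set of vertices carrying odd labels. Counting the edge ends at O gives
-- Σ_{v ∈ O} deg v = e(O, V ∖ O) + 2 e(O), so the number of edges whose labels differ in
-- parity has the parity of Σ_{v ∈ O} deg v. In a cubic graph on eight vertices |O| = 4,
-- that sum is 12, hence the rna number is even and cannot be 1.

module Submission where

open import Defs hiding (sym)
open import Relation.Nullary using (¬_)
open import Data.Bool using (Bool; true; false; _∧_; not)
open import Data.Fin using (Fin; zero; suc; toℕ)
open import Data.Fin.Permutation using (Permutation′)
open import Data.List using (map; tabulate; allFin)
open import Data.List.Properties using (map-tabulate)
open import Data.Nat using (ℕ; zero; suc; _+_; _*_; _%_; _≡ᵇ_; _<ᵇ_; _<_; s≤s)
open import Data.Nat.DivMod using (m%n<n)
open import Data.Nat.Properties using (+-*-semiring; *-identityˡ; +-identityʳ; *-zeroʳ; even≢odd)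
open import Data.Nat.Tactic.RingSolver using (solve-∀)
open import Data.Product using (_,_)
open import Relation.Binary.PropositionalEquality using (_≡_; refl; sym; trans; cong; module ≡-Reasoning)

import Data.Nat.ListAction as List
open import Algebra.Properties.Semiring.Sum +-*-semiring
  using (sum-syntax; sum-cong-≗; sum-replicate-zero; ∑-distrib-+; ∑-permute; *-distribˡ-sum; *-distribʳ-sum)

open ≡-Reasoning

sum-tabulate : ∀ {n} (f : Fin n → ℕ) → List.sum (tabulate f) ≡ ∑[ i < n ] f i
sum-tabulate {zero}  f = refl
sum-tabulate {suc n} f = cong (f zero +_) (sum-tabulate (λ i → f (suc i)))

sum-map-allFin : ∀ {n} (f : Fin n → ℕ) → List.sum (map f (allFin n)) ≡ ∑[ i < n ] f i
sum-map-allFin f = begin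
  List.sum (map f (tabulate (λ i → i))) ≡⟨ cong List.sum (map-tabulate (λ i → i) f) ⟩
  List.sum (tabulate f)                 ≡⟨ sum-tabulate f ⟩
  ∑[ i < _ ] f i                        ∎

∑-pairs : ∀ {n} (g : Fin n → Fin n → ℕ) →
          ∑[ u < n ] ∑[ v < n ] g u v ≡
          ∑[ u < n ] ∑[ v < n ] (⟦ toℕ u <ᵇ toℕ v ⟧ * (g u v + g v u)) + ∑[ u < n ] g u u
∑-pairs {zero}  g = refl
∑-pairs {suc n} g = begin
  (g₀₀ + ∑[ v < n ] g zero (suc v)) + ∑[ u < n ] (g (suc u) zero + ∑[ v < n ] g (suc u) (suc v))
    ≡⟨ cong (g₀₀ + Row +_) (∑-distrib-+ (λ u → g (suc u) zero) _) ⟩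
  (g₀₀ + Row) + (Col + ∑[ u < n ] ∑[ v < n ] g (suc u) (suc v))
    ≡⟨ cong (λ s → g₀₀ + Row + (Col + s)) (∑-pairs (λ u v → g (suc u) (suc v))) ⟩
  (g₀₀ + Row) + (Col + (R + D))
    ≡⟨ regroup g₀₀ Row Col R D ⟩
  (Row + Col) + R + (g₀₀ + D)
    ≡⟨ cong (λ s → s + R + (g₀₀ + D)) (sym (∑-distrib-+ (λ v → g zero (suc v)) _)) ⟩
  ∑[ v < n ] (g zero (suc v) + g (suc v) zero) + R + (g₀₀ + D)
    ≡⟨ cong (λ s → s + R + (g₀₀ + D)) (sum-cong-≗ {n} (λ v → sym (*-identityˡ (g zero (suc v) + g (suc v) zero)))) ⟩
  ∑[ v < n ] (1 * (g zero (suc v) + g (suc v) zero)) + R + (g₀₀ + D)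
    ∎
  where
  g₀₀ Row Col R D : ℕ
  g₀₀ = g zero zero
  Row = ∑[ v < n ] g zero (suc v)
  Col = ∑[ u < n ] g (suc u) zero
  R = ∑[ u < n ] ∑[ v < n ] (⟦ toℕ u <ᵇ toℕ v ⟧ * (g (suc u) (suc v) + g (suc v) (suc u)))
  D = ∑[ u < n ] g (suc u) (suc u)
  regroup : ∀ a b c r d → (a + b) + (c + (r + d)) ≡ (b + c) + r + (a + d)
  regroup = solve-∀

∑-+-* : ∀ {n} k (f g : Fin n → ℕ) → ∑[ i < n ] (f i + k * g i) ≡ ∑[ i < n ] f i + k * ∑[ i < n ] g i
∑-+-* k f g = trans (∑-distrib-+ f (λ i → k * g i)) (cong (∑[ i < _ ] f i +_) (sym (*-distribˡ-sum k g)))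

⟦∧⟧ : ∀ a b → ⟦ a ∧ b ⟧ ≡ ⟦ a ⟧ * ⟦ b ⟧
⟦∧⟧ false b = refl
⟦∧⟧ true  b = sym (*-identityˡ ⟦ b ⟧)

bit-sum : ∀ {x y} → x < 2 → y < 2 → x + y ≡ ⟦ not (x ≡ᵇ y) ⟧ + 2 * (x * y)
bit-sum {zero}        {zero}        _ _ = refl
bit-sum {zero}        {suc zero}    _ _ = refl
bit-sum {suc zero}    {zero}        _ _ = refl
bit-sum {suc zero}    {suc zero}    _ _ = refl
bit-sum {suc (suc _)} (s≤s (s≤s ())) _
bit-sum {_} {suc (suc _)} _ (s≤s (s≤s ()))

pair-split : ∀ c a {x y} → x < 2 → y < 2 →
             ⟦ c ⟧ * (x * ⟦ a ⟧ + y * ⟦ a ⟧) ≡ ⟦ c ∧ a ∧ not (x ≡ᵇ y) ⟧ + 2 * (⟦ c ⟧ * (⟦ a ⟧ * (x * y)))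
pair-split c a {x} {y} x<2 y<2 = begin
  ⟦ c ⟧ * (x * ⟦ a ⟧ + y * ⟦ a ⟧)            ≡⟨ factor ⟦ c ⟧ ⟦ a ⟧ x y ⟩
  ⟦ c ⟧ * (⟦ a ⟧ * (x + y))                  ≡⟨ cong (λ s → ⟦ c ⟧ * (⟦ a ⟧ * s)) (bit-sum x<2 y<2) ⟩
  ⟦ c ⟧ * (⟦ a ⟧ * (⟦ d ⟧ + 2 * (x * y)))      ≡⟨ expand ⟦ c ⟧ ⟦ a ⟧ ⟦ d ⟧ (x * y) ⟩
  ⟦ c ⟧ * (⟦ a ⟧ * ⟦ d ⟧) + twice             ≡⟨ cong (λ s → ⟦ c ⟧ * s + twice) (⟦∧⟧ a d) ⟨
  ⟦ c ⟧ * ⟦ a ∧ d ⟧ + twice                  ≡⟨ cong (_+ twice) (⟦∧⟧ c (a ∧ d)) ⟨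
  ⟦ c ∧ a ∧ d ⟧ + twice                      ∎
  where
  d : Bool
  d = not (x ≡ᵇ y)
  twice : ℕ
  twice = 2 * (⟦ c ⟧ * (⟦ a ⟧ * (x * y)))
  factor : ∀ c a x y → c * (x * a + y * a) ≡ c * (a * (x + y))
  factor = solve-∀
  expand : ∀ c a d p → c * (a * (d + 2 * p)) ≡ c * (a * d) + 2 * (c * (a * p))
  expand = solve-∀

parity : ∀ {n} → Permutation′ n → Fin n → ℕ
parity π v = label π v % 2

oddOddEdges : ∀ {n} → SimpleGraph n → Permutation′ n → ℕ
oddOddEdges {n} G π =
  ∑[ u < n ] ∑[ v < n ] (⟦ toℕ u <ᵇ toℕ v ⟧ * (⟦ adj G u v ⟧ * (parity π u * parity π v)))

oddEdges-∑ : ∀ {n} (G : SimpleGraph n) (π : Permutation′ n) →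
             oddEdges G π ≡
             ∑[ u < n ] ∑[ v < n ] ⟦ (toℕ u <ᵇ toℕ v) ∧ adj G u v ∧ differentParity (label π u) (label π v) ⟧
oddEdges-∑ {n} G π = trans (sum-map-allFin (λ u → List.sum (map (crossing u) (allFin n))))
                           (sum-cong-≗ (λ u → sum-map-allFin (crossing u)))
  where
  crossing : Fin n → Fin n → ℕ
  crossing u v = ⟦ (toℕ u <ᵇ toℕ v) ∧ adj G u v ∧ differentParity (label π u) (label π v) ⟧

∑-loops : ∀ {n} (G : SimpleGraph n) (f : Fin n → ℕ) → ∑[ u < n ] (f u * ⟦ adj G u u ⟧) ≡ 0
∑-loops {n} G f = trans (sum-cong-≗ (λ u → trans (cong (λ b → f u * ⟦ b ⟧) (loopless G u)) (*-zeroʳ (f u))))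
                        (sum-replicate-zero n)

oddEdges-handshake : ∀ {n} (G : SimpleGraph n) (π : Permutation′ n) →
                     oddEdges G π + 2 * oddOddEdges G π ≡ ∑[ v < n ] (parity π v * degree G v)
oddEdges-handshake {n} G π = begin
  oddEdges G π + 2 * oddOddEdges G π
    ≡⟨ cong (_+ 2 * oddOddEdges G π) (oddEdges-∑ G π) ⟩
  ∑[ u < n ] ∑[ v < n ] crossing u v + 2 * ∑[ u < n ] ∑[ v < n ] bothOdd u v
    ≡⟨ ∑-+-* 2 (λ u → ∑[ v < n ] crossing u v) (λ u → ∑[ v < n ] bothOdd u v) ⟨
  ∑[ u < n ] (∑[ v < n ] crossing u v + 2 * ∑[ v < n ] bothOdd u v)
    ≡⟨ sum-cong-≗ (λ u → ∑-+-* 2 (crossing u) (bothOdd u)) ⟨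
  ∑[ u < n ] ∑[ v < n ] (crossing u v + 2 * bothOdd u v)
    ≡⟨ sum-cong-≗ (λ u → sum-cong-≗ (λ v → edge u v)) ⟨
  Pairs
    ≡⟨ +-identityʳ Pairs ⟨
  Pairs + 0
    ≡⟨ cong (Pairs +_) (∑-loops G (parity π)) ⟨
  Pairs + ∑[ u < n ] h u u
    ≡⟨ ∑-pairs h ⟨
  ∑[ u < n ] ∑[ v < n ] h u v
    ≡⟨ sum-cong-≗ (λ u → *-distribˡ-sum (parity π u) (λ v → ⟦ adj G u v ⟧)) ⟨
  ∑[ u < n ] (parity π u * ∑[ v < n ] ⟦ adj G u v ⟧)
    ≡⟨ sum-cong-≗ (λ u → cong (parity π u *_) (sum-map-allFin (λ v → ⟦ adj G u v ⟧))) ⟨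
  ∑[ u < n ] (parity π u * degree G u)
    ∎
  where
  crossing bothOdd h : Fin n → Fin n → ℕ
  crossing u v = ⟦ (toℕ u <ᵇ toℕ v) ∧ adj G u v ∧ differentParity (label π u) (label π v) ⟧
  bothOdd  u v = ⟦ toℕ u <ᵇ toℕ v ⟧ * (⟦ adj G u v ⟧ * (parity π u * parity π v))
  h        u v = parity π u * ⟦ adj G u v ⟧

  Pairs : ℕ
  Pairs = ∑[ u < n ] ∑[ v < n ] (⟦ toℕ u <ᵇ toℕ v ⟧ * (h u v + h v u))

  edge : ∀ u v → ⟦ toℕ u <ᵇ toℕ v ⟧ * (h u v + h v u) ≡ crossing u v + 2 * bothOdd u v
  edge u v rewrite SimpleGraph.sym G v u =
    pair-split (toℕ u <ᵇ toℕ v) (adj G u v) (m%n<n (label π u) 2) (m%n<n (label π v) 2)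


lemma6p6 : (G : SimpleGraph 8) → Connected G → Cubic G → ¬ IsRnaNumber G 1
lemma6p6 G _ cubic ((π , oddEdges≡1) , _) = even≢odd 6 (oddOddEdges G π) (begin
  2 * 6                                          ≡⟨⟩
  (∑[ i < 8 ] (suc (toℕ i) % 2)) * 3             ≡⟨ cong (_* 3) (∑-permute (λ i → suc (toℕ i) % 2) π) ⟩
  (∑[ v < 8 ] parity π v) * 3                    ≡⟨ *-distribʳ-sum 3 (parity π) ⟩
  ∑[ v < 8 ] (parity π v * 3)                    ≡⟨ sum-cong-≗ (λ v → cong (parity π v *_) (cubic v)) ⟨
  ∑[ v < 8 ] (parity π v * degree G v)           ≡⟨ oddEdges-handshake G π ⟨
  oddEdges G π + 2 * oddOddEdges G π             ≡⟨ cong (_+ 2 * oddOddEdges G π) oddEdges≡1 ⟩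
  suc (2 * oddOddEdges G π)                      ∎)
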